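{- Let $G=(V,E_G)$ be a bipartite graph and let $H$ be a weighted edge-degree constrained subgraph of $G$ with parameters $\beta$ and $\beta^-=\beta-1$. Let $P$ be a path in $G$ with endpoints $s$ and $t$, and let $L(P)$ be the number of vertices of $P$. Suppose $L(P)$ is even and every even-numbered edge of $P$ (the second, fourth, etc., counted from $s$) is in $H$ (odd-numbered edges may or may not be in $H$). Then $$d_H(s)+d_H(t) \ge \beta - 1 - \frac{L(P)-2}{2}.$$
   Context: A weighted edge-degree constrained subgraph with parameters $(G,\beta,\beta^-)$ is a set $H\subseteq E_G$ with positive integer edge weights, where $d_H(v)$ is the total weight of the $H$-edges at $v$, such that (P1) every $(u,v)\in H$ has $d_H(u)+d_H(v)\le\beta$ and (P2) every $(u,v)\in E_G$ has $d_H(u)+d_H(v)\ge\beta^-$. -}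

module Defs where

open import Data.Nat using (ℕ; zero; suc; _+_; _≤_; _<_)
open import Data.Fin using (Fin)
open import Data.List using (map; allFin)
open import Data.Nat.ListAction using (sum)
open import Data.Bool using (Bool)
open import Data.Product using (Σ; _×_)
open import Relation.Binary.PropositionalEquality using (_≡_; _≢_)
open import Relation.Nullary using (¬_)

record Graph (n : ℕ) : Set₁ where
  field
    Adj   : Fin n → Fin n → Set
    sym   : ∀ {u v} → Adj u v → Adj v u
    irrefl : ∀ {u} → ¬ Adj u u

Bipartite : ∀ {n} → Graph n → Set
Bipartite {n} G = Σ (Fin n → Bool) λ c → ∀ {u v} → Graph.Adj G u v → c u ≢ c v

-- A weighted edge set H ⊆ E_G is encoded by a symmetric weight function
-- w : edges with w u v > 0 are the H-edges (carrying their positive weight),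
-- and w u v = 0 means (u,v) ∉ H.
record WeightedSubgraph {n : ℕ} (G : Graph n) : Set where
  field
    w     : Fin n → Fin n → ℕ
    w-sym : ∀ u v → w u v ≡ w v u
    w-sub : ∀ u v → 0 < w u v → Graph.Adj G u v

InH : ∀ {n} {G : Graph n} → WeightedSubgraph G → Fin n → Fin n → Set
InH H u v = 0 < WeightedSubgraph.w H u v

deg : ∀ {n} {G : Graph n} → WeightedSubgraph G → Fin n → ℕ
deg {n} H v = sum (map (WeightedSubgraph.w H v) (allFin n))

-- Weighted EDCS with parameters (G, β, β⁻).  The integer parameter β⁻ is
-- passed as a natural; (P2) is d_H(u)+d_H(v) ≥ β⁻.
IsWeightedEDCS : ∀ {n} (G : Graph n) → WeightedSubgraph G → ℕ → ℕ → Set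
IsWeightedEDCS G H β β⁻ =
  (∀ u v → InH H u v → deg H u + deg H v ≤ β) ×
  (∀ u v → Graph.Adj G u v → β⁻ ≤ deg H u + deg H v)

-- Along the path, each edge of G gives d(v₂ⱼ) + d(v₂ⱼ₊₁) ≥ β − 1 by (P2) and each
-- H-edge gives d(v₂ⱼ₊₁) + d(v₂ⱼ₊₂) ≤ β by (P1); together d(v₂ⱼ₊₂) ≤ d(v₂ⱼ) + 1.
-- So d(v_{L−2}) ≤ d(v₀) + (L − 2)/2, and (P2) on the last edge gives the bound.
module Submission where

open import Defs
open import Data.Nat using (ℕ; zero; suc; s≤s; _+_; _∸_; _≤_; ⌊_/2⌋; _%_)
open import Data.Nat.Properties
  using (≤-reflexive; ≤-trans; +-suc; +-comm; +-identityʳ; +-cancelˡ-≤; +-monoˡ-≤; m≤n+m∸n; module ≤-Reasoning)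
open import Data.Nat.Divisibility using (_∣_; n∣m⇒m%n≡0)
open import Data.Fin using (Fin; zero; suc; toℕ; inject₁; fromℕ)
open import Data.Product using (_,_)
open import Function.Definitions using (Injective)
open import Relation.Binary.PropositionalEquality using (_≡_; refl; sym; cong)

tight-pair-≤suc : ∀ {β a b c} → a + b ≤ β → β ∸ 1 ≤ c + a → b ≤ suc c
tight-pair-≤suc {β} {a} {b} {c} a+b≤β β∸1≤c+a = +-cancelˡ-≤ a b (suc c) (begin
  a + b        ≤⟨ a+b≤β ⟩
  β            ≤⟨ m≤n+m∸n β 1 ⟩
  suc (β ∸ 1)  ≤⟨ s≤s β∸1≤c+a ⟩
  suc (c + a)  ≡⟨ cong suc (+-comm c a) ⟩
  suc (a + c)  ≡⟨ sym (+-suc a c) ⟩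
  a + suc c    ∎)
  where open ≤-Reasoning

-- Edge i joins vertices i and i + 1; counting edges from 0, the odd ones are the paper's
-- even-numbered (H-)edges.
alternating-path-bound : ∀ {β} m (d : Fin (suc m) → ℕ) → suc m % 2 ≡ 0 →
  (∀ i → β ∸ 1 ≤ d (inject₁ i) + d (suc i)) →
  (∀ i → toℕ i % 2 ≡ 1 → d (inject₁ i) + d (suc i) ≤ β) →
  β ∸ 1 ≤ d zero + d (fromℕ m) + ⌊ (suc m ∸ 2) /2⌋
alternating-path-bound zero d () lower upper
alternating-path-bound (suc zero) d even lower upper =
  ≤-trans (lower zero) (≤-reflexive (sym (+-identityʳ _)))
alternating-path-bound (suc (suc zero)) d () lower upper
alternating-path-bound {β} (suc (suc (suc m))) d even lower upper = begin
  β ∸ 1                              ≤⟨ alternating-path-bound (suc m) (λ i → d (suc (suc i))) even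
                                           (λ i → lower (suc (suc i))) (λ i → upper (suc (suc i))) ⟩
  d v₂ + d last + ⌊ m /2⌋            ≤⟨ +-monoˡ-≤ ⌊ m /2⌋ (+-monoˡ-≤ (d last) v₂≤1+v₀) ⟩
  suc (d zero + d last + ⌊ m /2⌋)    ≡⟨ sym (+-suc _ ⌊ m /2⌋) ⟩
  d zero + d last + suc ⌊ m /2⌋      ∎
  where
  open ≤-Reasoning
  v₂ last : Fin (4 + m)
  v₂ = suc (suc zero)
  last = fromℕ (3 + m)
  v₂≤1+v₀ : d v₂ ≤ suc (d zero)
  v₂≤1+v₀ = tight-pair-≤suc (upper (suc zero) refl) (lower zero)

lemma4 : ∀ {n} (G : Graph n) → Bipartite G →
    (H : WeightedSubgraph G) (β : ℕ) → IsWeightedEDCS G H β (β ∸ 1) →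
    (m : ℕ) (P : Fin (suc m) → Fin n) → Injective _≡_ _≡_ P →
    (∀ (i : Fin m) → Graph.Adj G (P (inject₁ i)) (P (suc i))) →
    2 ∣ suc m →
    (∀ (i : Fin m) → toℕ i % 2 ≡ 1 → InH H (P (inject₁ i)) (P (suc i))) →
    β ∸ 1 ≤ deg H (P zero) + deg H (P (fromℕ m)) + ⌊ (suc m ∸ 2) /2⌋
lemma4 G _ H β (P1 , P2) m P _ adj 2∣L inH =
  alternating-path-bound m (λ i → deg H (P i)) (n∣m⇒m%n≡0 (suc m) 2 2∣L)
    (λ i → P2 _ _ (adj i))
    (λ i odd → P1 _ _ (inH i odd))
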